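{- Let $p$ be a prime, $s\geq 1$, and let $\varphi$ be an irreducible support map of length $\ell$ with $t$ jumps, where $1\leq t\leq s$. Write $\ell=qs+r$ with $q\geq0$ and $1\leq r\leq s$. Then $$\sum_{i\in\mathbb{Z}/\ell\mathbb{Z}}\varphi(i)\geq \sum_{i=1}^{\ell}c_i\geq \frac{s(s+1)}{2}\cdot\frac{p^q-1}{p-1}+\frac{r(r+1)}{2}p^q,$$ where $(c_i)_{i\geq1}$ is the increasing enumeration of $F_s=\bigcup_{b\in E_s}\{p^jb:\ j\geq 0\}$ with $E_s=\{1\leq i\leq s+\lceil \frac{s}{p-1}-1\rceil:\ \gcd(i,p)=1\}$.
   Context: A map $\varphi:\mathbb{Z}/\ell\mathbb{Z}\to\mathbb{Z}_{>0}$ is a support map of length $\ell$ with $t$ jumps ($\ell\geq t$) if $\varphi(i+1)=p\varphi(i)$ for all $i$ except exactly $t$ pairwise distinct values, for which $\varphi(i+1)<p\varphi(i)$. It is irreducible if it is injective. -}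

module Defs where

open import Data.Nat using (ℕ; zero; suc; _+_; _*_; _∸_; _^_; _≤_; _<_; _<?_)
open import Data.Nat.DivMod using (_/_; _mod_)
open import Data.Nat.GCD using (gcd)
open import Data.Nat.Primality using (Prime)
open import Data.Fin using (Fin; toℕ)
open import Data.List using (List; length; filter; map; upTo; allFin; tabulate)
open import Data.Nat.ListAction using (sum)
open import Data.Product using (Σ; ∃; _×_)
open import Function.Definitions using (Injective)
open import Relation.Binary.PropositionalEquality using (_≡_)

-- successor i ↦ i+1 in ℤ/ℓℤ, with ℤ/ℓℤ represented by Fin ℓ
next : ∀ {ℓ} → Fin ℓ → Fin ℓ
next {suc n} i = suc (toℕ i) mod suc n

jumpCount : (p : ℕ) {ℓ : ℕ} → (Fin ℓ → ℕ) → ℕ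
jumpCount p {ℓ} φ = length (filter (λ i → φ (next i) <? p * φ i) (allFin ℓ))

record IsSupportMap (p ℓ t : ℕ) (φ : Fin ℓ → ℕ) : Set where
  field
    positive  : ∀ i → 0 < φ i
    t≤ℓ       : t ≤ ℓ
    stepOrJump : ∀ i → φ (next i) ≤ p * φ i   -- φ(i+1) = pφ(i) except at jumps, where φ(i+1) < pφ(i)
    jumps     : jumpCount p φ ≡ t

IsIrreducible : ∀ {ℓ} → (Fin ℓ → ℕ) → Set
IsIrreducible φ = Injective _≡_ _≡_ φ

-- ⌈a / b⌉ for b ≥ 1 (junk value 0 for b = 0)
ceilDiv : ℕ → ℕ → ℕ
ceilDiv a zero = 0
ceilDiv a (suc k) = (a + k) / suc k

-- b ∈ E_s = { 1 ≤ i ≤ s + ⌈s/(p-1) - 1⌉ : gcd(i,p) = 1 };  note ⌈s/(p-1) - 1⌉ = ⌈s/(p-1)⌉ - 1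
InE : (p s b : ℕ) → Set
InE p s b = (1 ≤ b) × (b ≤ s + ceilDiv s (p ∸ 1) ∸ 1) × (gcd b p ≡ 1)

InF : (p s n : ℕ) → Set
InF p s n = Σ ℕ λ j → Σ ℕ λ b → InE p s b × (n ≡ p ^ j * b)

-- c is the increasing enumeration of F_s (c 0 = c_1, c 1 = c_2, ...)
record IsIncreasingEnumOfF (p s : ℕ) (c : ℕ → ℕ) : Set where
  field
    strictlyIncreasing : ∀ i → c i < c (suc i)
    inF   : ∀ i → InF p s (c i)
    onto  : ∀ n → InF p s n → ∃ λ i → c i ≡ n

sumFin : ∀ {ℓ} → (Fin ℓ → ℕ) → ℕ
sumFin φ = sum (tabulate φ)

-- Σ_{i=1}^{ℓ} c_i  = c 0 + ... + c (ℓ-1) in 0-based indexing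
sumFirst : ℕ → (ℕ → ℕ) → ℕ
sumFirst ℓ c = sum (map c (upTo ℓ))

-- (p^q - 1)/(p - 1) written as the geometric sum 1 + p + ... + p^(q-1)
geom : ℕ → ℕ → ℕ
geom p zero = 0
geom p (suc q) = p ^ q + geom p q

{-# OPTIONS --safe #-}
-- Call a family of positive integers s-sparse if, for every N, at most s of its members lie in
-- the window N/p < x ≤ N. Counting members ≤ N layer by layer (those ≤ N/p, then the window)
-- shows that an injective s-sparse family has at most capacity(N) = Σ_j min(s, #{p-free x ≤ N/p^j})
-- members ≤ N, and F_s, whose j-th layer is p^j E_s with |E_s| = s, attains this capacity.
-- The values of an irreducible support map with t ≤ s jumps are s-sparse: from a value in the window
-- a step without a jump leaves {φ ≤ N}, which only a jump can re-enter. Comparing counting functions,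
-- the k-th smallest value of φ is at least c_k, giving the first inequality. F_s is s-sparse as
-- well, which yields c_{js+m+1} ≥ (m+1) p^j; summing over blocks of length s gives the second.
module Submission where

open import Algebra.Properties.CommutativeSemigroup using (interchange; x∙yz≈y∙xz)
open import Data.Empty using (⊥-elim)
open import Data.Fin using (Fin; zero; suc; toℕ)
open import Data.Fin.Properties using (toℕ-fromℕ<; toℕ<n; toℕ-injective)
open import Data.List using ([]; _∷_; length; filter; map; tabulate; applyUpTo; allFin)
open import Data.List.Properties using (map-tabulate)
open import Data.Nat
open import Data.Nat.Coprimality using (gcd≡1⇒coprime)
open import Data.Nat.DivMod
open import Data.Nat.Divisibility using (_∣_; _∣?_; divides; ∣-refl; m∣m*n; n∣m⇒m%n≡0)
open import Data.Nat.GCD using (gcd; gcd[m,n]∣m; gcd[m,n]∣n)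
open import Data.Nat.ListAction using (sum)
open import Data.Nat.Primality using (Prime; prime⇒irreducible; ¬prime[0]; ¬prime[1])
open import Data.Nat.Properties
open import Data.Nat.Solver using (module +-*-Solver)
open import Data.Product using (∃; _×_; _,_; proj₁; proj₂)
open import Data.Sum using (_⊎_; inj₁; inj₂)
open import Data.Unit using (⊤; tt)
open import Function using (_∘_; id)
open import Level using (0ℓ)
open import Relation.Binary.Definitions using (tri<; tri≈; tri>)
open import Relation.Binary.PropositionalEquality
  using (_≡_; refl; sym; trans; cong; cong₂; subst; module ≡-Reasoning)
open import Relation.Nullary using (Dec; yes; no; ¬_)
open import Relation.Nullary.Decidable using (_×-dec_; ¬?)
open import Relation.Unary using (Pred; Decidable)

open import Defs

∑ : ℕ → (ℕ → ℕ) → ℕ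
∑ zero    f = 0
∑ (suc n) f = f 0 + ∑ n (f ∘ suc)

infix 5 ∑
syntax ∑ n (λ k → e) = ∑[ k < n ] e

∑-cong : ∀ n {f g} → (∀ k → k < n → f k ≡ g k) → ∑ n f ≡ ∑ n g
∑-cong zero    f≡g = refl
∑-cong (suc n) f≡g = cong₂ _+_ (f≡g 0 z<s) (∑-cong n (λ k k<n → f≡g (suc k) (s<s k<n)))

∑-mono-≤ : ∀ n {f g} → (∀ k → k < n → f k ≤ g k) → ∑ n f ≤ ∑ n g
∑-mono-≤ zero    f≤g = z≤n
∑-mono-≤ (suc n) f≤g = +-mono-≤ (f≤g 0 z<s) (∑-mono-≤ n (λ k k<n → f≤g (suc k) (s<s k<n)))

∑-const : ∀ n a → ∑ n (λ _ → a) ≡ n * a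
∑-const zero    a = refl
∑-const (suc n) a = cong (a +_) (∑-const n a)

∑-distrib-+ : ∀ n f g → ∑[ k < n ] (f k + g k) ≡ ∑ n f + ∑ n g
∑-distrib-+ zero    f g = refl
∑-distrib-+ (suc n) f g =
  trans (cong (f 0 + g 0 +_) (∑-distrib-+ n (f ∘ suc) (g ∘ suc)))
        (interchange +-commutativeSemigroup (f 0) (g 0) _ _)

∑-distribˡ-* : ∀ n a f → ∑[ k < n ] (a * f k) ≡ a * ∑ n f
∑-distribˡ-* zero    a f = sym (*-zeroʳ a)
∑-distribˡ-* (suc n) a f =
  trans (cong (a * f 0 +_) (∑-distribˡ-* n a (f ∘ suc))) (sym (*-distribˡ-+ a (f 0) _))

∑-distribʳ-* : ∀ n a f → ∑[ k < n ] (f k * a) ≡ ∑ n f * a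
∑-distribʳ-* n a f =
  trans (∑-cong n (λ k _ → *-comm (f k) a)) (trans (∑-distribˡ-* n a f) (*-comm a (∑ n f)))

∑-split : ∀ m n f → ∑ (m + n) f ≡ ∑ m f + (∑[ k < n ] f (m + k))
∑-split zero    n f = refl
∑-split (suc m) n f = trans (cong (f 0 +_) (∑-split m n (f ∘ suc))) (sym (+-assoc (f 0) _ _))

∑-snoc : ∀ n f → ∑ (suc n) f ≡ ∑ n f + f n
∑-snoc zero    f = +-comm (f 0) 0
∑-snoc (suc n) f = trans (cong (f 0 +_) (∑-snoc n (f ∘ suc))) (sym (+-assoc (f 0) _ _))

∑-comm : ∀ m n (h : ℕ → ℕ → ℕ) → ∑[ i < m ] ∑[ j < n ] h i j ≡ ∑[ j < n ] ∑[ i < m ] h i j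
∑-comm zero    n h = sym (trans (∑-const n 0) (*-zeroʳ n))
∑-comm (suc m) n h = trans (cong (∑ n (h 0) +_) (∑-comm m n (h ∘ suc)))
  (sym (∑-distrib-+ n (h 0) (λ j → ∑[ i < m ] h (suc i) j)))

term≤∑ : ∀ n f {x} → x < n → f x ≤ ∑ n f
term≤∑ (suc n) f {zero}  _         = m≤m+n (f 0) _
term≤∑ (suc n) f {suc x} (s<s x<n) = ≤-trans (term≤∑ n (f ∘ suc) x<n) (m≤n+m _ (f 0))

∑-shift-periodic : ∀ n f → f n ≡ f 0 → ∑ n (f ∘ suc) ≡ ∑ n f
∑-shift-periodic n f fn≡f0 = +-cancelʳ-≡ (f 0) _ _ (begin
  ∑ n (f ∘ suc) + f 0 ≡⟨ +-comm _ (f 0) ⟩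
  ∑ (suc n) f         ≡⟨ ∑-snoc n f ⟩
  ∑ n f + f n         ≡⟨ cong (∑ n f +_) fn≡f0 ⟩
  ∑ n f + f 0         ∎)
  where open ≡-Reasoning

∑-blocks : ∀ q s f → ∑ (q * s) f ≡ ∑[ j < q ] ∑[ m < s ] f (j * s + m)
∑-blocks zero    s f = refl
∑-blocks (suc q) s f = trans (∑-split s (q * s) f) (cong (∑ s f +_)
  (trans (∑-blocks q s (λ x → f (s + x)))
         (∑-cong q (λ j _ → ∑-cong s (λ m _ → cong f (sym (+-assoc s (j * s) m)))))))

∑-ones : ∀ n → ∑ n (λ _ → 1) ≡ n
∑-ones n = trans (∑-const n 1) (*-identityʳ n)

sum-map-applyUpTo : ∀ n (g f : ℕ → ℕ) → sum (map g (applyUpTo f n)) ≡ ∑[ k < n ] g (f k)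
sum-map-applyUpTo zero    g f = refl
sum-map-applyUpTo (suc n) g f = cong (g (f 0) +_) (sum-map-applyUpTo n g (f ∘ suc))

∑-suc : ∀ n → ∑ n suc ≡ n * suc n / 2
∑-suc n = sym (trans (cong (_/ 2) (sym (twice n))) (m*n/n≡m (∑ n suc) 2))
  where
  open +-*-Solver
  twice : ∀ n → ∑ n suc * 2 ≡ n * suc n
  twice zero    = refl
  twice (suc n) = begin
    ∑ (suc n) suc * 2           ≡⟨ cong (_* 2) (∑-snoc n suc) ⟩
    (∑ n suc + suc n) * 2       ≡⟨ *-distribʳ-+ 2 (∑ n suc) (suc n) ⟩
    ∑ n suc * 2 + suc n * 2     ≡⟨ cong (_+ suc n * 2) (twice n) ⟩
    n * suc n + suc n * 2       ≡⟨ solve 1 (λ n → n :* (con 1 :+ n) :+ (con 1 :+ n) :* con 2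
                                                := (con 1 :+ n) :* (con 2 :+ n)) refl n ⟩
    suc n * suc (suc n)         ∎
    where open ≡-Reasoning

*-geom : ∀ a p q → a * geom p q ≡ ∑[ j < q ] a * p ^ j
*-geom a p zero    = *-zeroʳ a
*-geom a p (suc q) = begin
  a * (p ^ q + geom p q)                ≡⟨ *-distribˡ-+ a (p ^ q) (geom p q) ⟩
  a * p ^ q + a * geom p q              ≡⟨ +-comm (a * p ^ q) _ ⟩
  a * geom p q + a * p ^ q              ≡⟨ cong (_+ a * p ^ q) (*-geom a p q) ⟩
  (∑[ j < q ] a * p ^ j) + a * p ^ q    ≡⟨ ∑-snoc q (λ j → a * p ^ j) ⟨
  ∑[ j < suc q ] a * p ^ j              ∎
  where open ≡-Reasoning

𝟙 : {A : Set} → Dec A → ℕ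
𝟙 (yes _) = 1
𝟙 (no _)  = 0

𝟙≤1 : {A : Set} (d : Dec A) → 𝟙 d ≤ 1
𝟙≤1 (yes _) = ≤-refl
𝟙≤1 (no _)  = z≤n

𝟙-yes : {A : Set} (d : Dec A) → A → 𝟙 d ≡ 1
𝟙-yes (yes _) _ = refl
𝟙-yes (no ¬a) a = ⊥-elim (¬a a)

𝟙-no : {A : Set} (d : Dec A) → ¬ A → 𝟙 d ≡ 0
𝟙-no (yes a) ¬a = ⊥-elim (¬a a)
𝟙-no (no _)  _  = refl

𝟙-mono : {A B : Set} (dA : Dec A) (dB : Dec B) → (A → B) → 𝟙 dA ≤ 𝟙 dB
𝟙-mono (yes a) dB      A→B = ≤-reflexive (sym (𝟙-yes dB (A→B a)))
𝟙-mono (no _)  _       _   = z≤n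

𝟙-cong : {A B : Set} (dA : Dec A) (dB : Dec B) → (A → B) → (B → A) → 𝟙 dA ≡ 𝟙 dB
𝟙-cong dA dB A→B B→A = ≤-antisym (𝟙-mono dA dB A→B) (𝟙-mono dB dA B→A)

count : ∀ n {P : Pred ℕ 0ℓ} → Decidable P → ℕ
count n P? = ∑[ k < n ] 𝟙 (P? k)

module _ {P : Pred ℕ 0ℓ} (P? : Decidable P) where

  count≤ : ∀ n → count n P? ≤ n
  count≤ n = ≤-trans (∑-mono-≤ n (λ k _ → 𝟙≤1 (P? k))) (≤-reflexive (∑-ones n))

  count-all : ∀ n → (∀ k → k < n → P k) → count n P? ≡ n
  count-all n all = trans (∑-cong n (λ k k<n → 𝟙-yes (P? k) (all k k<n))) (∑-ones n)

  count-none : ∀ n → (∀ k → k < n → ¬ P k) → count n P? ≡ 0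
  count-none n none = trans (∑-cong n (λ k k<n → 𝟙-no (P? k) (none k k<n)))
                            (trans (∑-const n 0) (*-zeroʳ n))

count-partition : ∀ n {P Q : Pred ℕ 0ℓ} (P? : Decidable P) (Q? : Decidable Q) →
  count n P? ≡ count n (λ k → P? k ×-dec ¬? (Q? k)) + count n (λ k → P? k ×-dec Q? k)
count-partition n P? Q? = trans (∑-cong n (λ k _ → pointwise (P? k) (Q? k))) (∑-distrib-+ n _ _)
  where
  pointwise : ∀ {A B : Set} (dA : Dec A) (dB : Dec B) → 𝟙 dA ≡ 𝟙 (dA ×-dec ¬? dB) + 𝟙 (dA ×-dec dB)
  pointwise (yes _) (yes _) = refl
  pointwise (yes _) (no _)  = refl
  pointwise (no _)  _       = refl

count-atMostOne : ∀ n {P : Pred ℕ 0ℓ} (P? : Decidable P) →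
  (∀ x y → x < n → y < n → P x → P y → x ≡ y) → count n P? ≤ 1
count-atMostOne zero    P? unique = z≤n
count-atMostOne (suc n) P? unique with P? 0
... | yes p0 = ≤-reflexive (cong suc (count-none (P? ∘ suc) n
                 (λ k k<n pk → 0≢1+n (unique 0 (suc k) z<s (s<s k<n) p0 pk))))
... | no _   = count-atMostOne n (P? ∘ suc)
                 (λ x y x<n y<n px py → suc-injective (unique (suc x) (suc y) (s<s x<n) (s<s y<n) px py))

count-mono : ∀ n {P Q : Pred ℕ 0ℓ} (P? : Decidable P) (Q? : Decidable Q) →
  (∀ k → k < n → P k → Q k) → count n P? ≤ count n Q?
count-mono n P? Q? P⇒Q = ∑-mono-≤ n (λ k k<n → 𝟙-mono (P? k) (Q? k) (P⇒Q k k<n))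

∑-select : ∀ n (g : ℕ → ℕ) {x} → x < n → ∑[ y < n ] 𝟙 (x ≟ y) * g y ≡ g x
∑-select (suc n) g {zero}  _ =
  trans (cong (g 0 + 0 +_) (trans (∑-const n 0) (*-zeroʳ n))) (trans (+-identityʳ _) (+-identityʳ _))
∑-select (suc n) g {suc x} (s<s x<n) = trans
  (∑-cong n (λ y _ → cong (_* g (suc y)) (𝟙-cong (suc x ≟ suc y) (x ≟ y) suc-injective (cong suc))))
  (∑-select n (g ∘ suc) x<n)

count-singleton : ∀ n {x} → x < n → count n (x ≟_) ≡ 1
count-singleton n {x} x<n =
  trans (∑-cong n (λ y _ → sym (*-identityʳ (𝟙 (x ≟ y))))) (∑-select n (λ _ → 1) x<n)

count-insert : ∀ n {P Q : Pred ℕ 0ℓ} (P? : Decidable P) (Q? : Decidable Q) {x} → x < n →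
  ¬ P x → Q x → (∀ k → k < n → P k → Q k) → suc (count n P?) ≤ count n Q?
count-insert n P? Q? {x} x<n ¬px qx P⇒Q = begin
  suc (count n P?)                          ≡⟨ +-comm 1 _ ⟩
  count n P? + 1                            ≡⟨ cong (count n P? +_) (sym (count-singleton n x<n)) ⟩
  count n P? + count n (x ≟_)               ≡⟨ ∑-distrib-+ n (λ k → 𝟙 (P? k)) (λ k → 𝟙 (x ≟ k)) ⟨
  ∑[ k < n ] (𝟙 (P? k) + 𝟙 (x ≟ k))         ≤⟨ ∑-mono-≤ n pointwise ⟩
  count n Q?                                ∎
  where
  open ≤-Reasoning
  pointwise : ∀ k → k < n → 𝟙 (P? k) + 𝟙 (x ≟ k) ≤ 𝟙 (Q? k)
  pointwise k k<n with x ≟ k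
  ... | yes refl = ≤-reflexive (trans (cong (_+ 1) (𝟙-no (P? x) ¬px)) (sym (𝟙-yes (Q? x) qx)))
  ... | no _     = ≤-trans (≤-reflexive (+-identityʳ _)) (𝟙-mono (P? k) (Q? k) (P⇒Q k k<n))

count-≤-matching : ∀ a b {P Q : Pred ℕ 0ℓ} (P? : Decidable P) (Q? : Decidable Q)
  {R : ℕ → ℕ → Set} (R? : ∀ x y → Dec (R x y)) →
  (∀ x → x < a → P x → ∃ λ y → y < b × R x y) →
  (∀ x y → x < a → y < b → R x y → Q y) →
  (∀ x x′ y → x < a → x′ < a → y < b → R x y → R x′ y → x ≡ x′) →
  count a P? ≤ count b Q?
count-≤-matching a b P? Q? R? matched R⇒Q R-unique = begin
  ∑[ x < a ] 𝟙 (P? x)                 ≤⟨ ∑-mono-≤ a P≤row ⟩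
  ∑[ x < a ] ∑[ y < b ] 𝟙 (R? x y)    ≡⟨ ∑-comm a b (λ x y → 𝟙 (R? x y)) ⟩
  ∑[ y < b ] ∑[ x < a ] 𝟙 (R? x y)    ≤⟨ ∑-mono-≤ b column≤Q ⟩
  ∑[ y < b ] 𝟙 (Q? y)                 ∎
  where
  open ≤-Reasoning
  P≤row : ∀ x → x < a → 𝟙 (P? x) ≤ ∑[ y < b ] 𝟙 (R? x y)
  P≤row x x<a with P? x
  ... | no _  = z≤n
  ... | yes px with matched x x<a px
  ...   | y , y<b , rxy = ≤-trans (≤-reflexive (sym (𝟙-yes (R? x y) rxy))) (term≤∑ b (λ y → 𝟙 (R? x y)) y<b)
  column≤Q : ∀ y → y < b → count a (λ x → R? x y) ≤ 𝟙 (Q? y)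
  column≤Q y y<b with Q? y
  ... | yes _ = count-atMostOne a (λ x → R? x y) (λ x x′ x<a x′<a → R-unique x x′ y x<a x′<a y<b)
  ... | no ¬qy = ≤-reflexive (count-none (λ x → R? x y) a (λ x x<a rxy → ¬qy (R⇒Q x y x<a y<b rxy)))

count-≤-injection : ∀ a b {P Q : Pred ℕ 0ℓ} (P? : Decidable P) (Q? : Decidable Q) (f : ℕ → ℕ) →
  (∀ x → x < a → P x → f x < b × Q (f x)) →
  (∀ x x′ → x < a → x′ < a → P x → P x′ → f x ≡ f x′ → x ≡ x′) →
  count a P? ≤ count b Q?
count-≤-injection a b P? Q? f into inj = count-≤-matching a b P? Q? (λ x y → P? x ×-dec (f x ≟ y))
  (λ x x<a px → f x , proj₁ (into x x<a px) , px , refl)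
  (λ { x _ x<a _ (px , refl) → proj₂ (into x x<a px) })
  (λ { x x′ _ x<a x′<a _ (px , fx≡y) (px′ , fx′≡y) → inj x x′ x<a x′<a px px′ (trans fx≡y (sym fx′≡y)) })

count-≤-cover : ∀ a b {P Q : Pred ℕ 0ℓ} (P? : Decidable P) (Q? : Decidable Q) (g : ℕ → ℕ) →
  (∀ x → x < a → P x → ∃ λ y → y < b × Q y × g y ≡ x) →
  count a P? ≤ count b Q?
count-≤-cover a b P? Q? g covered = count-≤-matching a b P? Q? (λ x y → Q? y ×-dec (g y ≟ x))
  (λ x x<a px → let (y , y<b , qy , gy≡x) = covered x x<a px in y , y<b , qy , gy≡x)
  (λ _ _ _ _ → proj₁)
  (λ { _ _ _ _ _ _ (_ , gy≡x) (_ , gy≡x′) → trans (sym gy≡x) gy≡x′ })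

∑≡n⇒all≡1 : ∀ n (f : ℕ → ℕ) → (∀ k → k < n → f k ≤ 1) → ∑ n f ≡ n → ∀ k → k < n → f k ≡ 1
∑≡n⇒all≡1 (suc n) f f≤1 ∑≡ = λ where
    zero    _         → head≡1
    (suc k) (s<s k<n) → ∑≡n⇒all≡1 n (f ∘ suc) (λ j j<n → f≤1 (suc j) (s<s j<n)) tail≡n k k<n
  where
  tail≤n : ∑ n (f ∘ suc) ≤ n
  tail≤n = ≤-trans (∑-mono-≤ n (λ k k<n → f≤1 (suc k) (s<s k<n))) (≤-reflexive (∑-ones n))
  head≡1 : f 0 ≡ 1
  head≡1 = ≤-antisym (f≤1 0 z<s)
    (+-cancelʳ-≤ (∑ n (f ∘ suc)) 1 (f 0) (≤-trans (s≤s tail≤n) (≤-reflexive (sym ∑≡))))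
  tail≡n : ∑ n (f ∘ suc) ≡ n
  tail≡n = suc-injective (trans (cong (_+ ∑ n (f ∘ suc)) (sym head≡1)) ∑≡)

∑-reindex : ∀ n (ρ g : ℕ → ℕ) →
  (∀ k → k < n → ρ k < n) → (∀ k k′ → k < n → k′ < n → ρ k ≡ ρ k′ → k ≡ k′) →
  ∑[ k < n ] g (ρ k) ≡ ∑ n g
∑-reindex n ρ g into inj = begin
  ∑[ k < n ] g (ρ k)                          ≡⟨ ∑-cong n (λ k k<n → sym (∑-select n g (into k k<n))) ⟩
  ∑[ k < n ] ∑[ y < n ] 𝟙 (ρ k ≟ y) * g y   ≡⟨ ∑-comm n n (λ k y → 𝟙 (ρ k ≟ y) * g y) ⟩
  ∑[ y < n ] ∑[ k < n ] 𝟙 (ρ k ≟ y) * g y   ≡⟨ ∑-cong n (λ y _ → ∑-distribʳ-* n (g y) (λ k → 𝟙 (ρ k ≟ y))) ⟩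
  ∑[ y < n ] fibre y * g y                    ≡⟨ ∑-cong n (λ y y<n → cong (_* g y) (fibre≡1 y y<n)) ⟩
  ∑[ y < n ] 1 * g y                          ≡⟨ ∑-cong n (λ y _ → *-identityˡ (g y)) ⟩
  ∑ n g                                       ∎
  where
  open ≡-Reasoning
  fibre : ℕ → ℕ
  fibre y = count n (λ k → ρ k ≟ y)
  ∑fibre≡n : ∑ n fibre ≡ n
  ∑fibre≡n = trans (∑-comm n n (λ y k → 𝟙 (ρ k ≟ y)))
    (trans (∑-cong n (λ k k<n → count-singleton n (into k k<n))) (∑-ones n))
  fibre≡1 : ∀ y → y < n → fibre y ≡ 1
  fibre≡1 = ∑≡n⇒all≡1 n fibre
    (λ y _ → count-atMostOne n (λ k → ρ k ≟ y) (λ k k′ k<n k′<n e e′ → inj k k′ k<n k′<n (trans e (sym e′))))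
    ∑fibre≡n

module _ (n : ℕ) (ψ : ℕ → ℕ) (ψ-injective : ∀ k k′ → k < n → k′ < n → ψ k ≡ ψ k′ → k ≡ k′) where

  rank : ℕ → ℕ
  rank k = count n (λ k′ → ψ k′ <? ψ k)

  private
    1+rank≤count : ∀ {k} {Q : Pred ℕ 0ℓ} (Q? : Decidable Q) → k < n → Q k →
      (∀ k′ → ψ k′ < ψ k → Q k′) → suc (rank k) ≤ count n Q?
    1+rank≤count {k} Q? k<n qk below⇒Q =
      count-insert n (λ k′ → ψ k′ <? ψ k) Q? k<n (n≮n (ψ k)) qk (λ k′ _ → below⇒Q k′)

  rank<n : ∀ k → k < n → rank k < n
  rank<n k k<n = ≤-trans (1+rank≤count (λ k′ → ψ k′ ≤? ψ k) k<n ≤-refl (λ _ → <⇒≤))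
                         (count≤ (λ k′ → ψ k′ ≤? ψ k) n)

  rank-mono-< : ∀ k k′ → k < n → ψ k < ψ k′ → rank k < rank k′
  rank-mono-< k k′ k<n ψk<ψk′ = 1+rank≤count (λ j → ψ j <? ψ k′) k<n ψk<ψk′ (λ _ lt → <-trans lt ψk<ψk′)

  rank-injective : ∀ k k′ → k < n → k′ < n → rank k ≡ rank k′ → k ≡ k′
  rank-injective k k′ k<n k′<n eq with <-cmp (ψ k) (ψ k′)
  ... | tri< lt _ _ = ⊥-elim (<⇒≢ (rank-mono-< k k′ k<n lt) eq)
  ... | tri≈ _ e _  = ψ-injective k k′ k<n k′<n e
  ... | tri> _ _ gt = ⊥-elim (<⇒≢ (rank-mono-< k′ k k′<n gt) (sym eq))

  ∑≤∑-byRank : (c : ℕ → ℕ) → (∀ R → count n (λ k → ψ k <? c R) ≤ R) → ∑ n c ≤ ∑ n ψ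
  ∑≤∑-byRank c few-below = begin
    ∑ n c                  ≡⟨ ∑-reindex n rank c rank<n rank-injective ⟨
    ∑[ k < n ] c (rank k)  ≤⟨ ∑-mono-≤ n c∘rank≤ψ ⟩
    ∑ n ψ                  ∎
    where
    open ≤-Reasoning
    c∘rank≤ψ : ∀ k → k < n → c (rank k) ≤ ψ k
    c∘rank≤ψ k k<n with ψ k <? c (rank k)
    ... | no ψk≮c = ≮⇒≥ ψk≮c
    ... | yes ψk<c = ⊥-elim (<⇒≱ (1+rank≤count (λ j → ψ j <? c (rank k)) k<n ψk<c (λ _ lt → <-trans lt ψk<c))
                                   (few-below (rank k)))

-- Support maps as periodic sequences

length-filter≡∑𝟙 : ∀ {A : Set} {P : Pred A 0ℓ} (P? : Decidable P) xs →
  length (filter P? xs) ≡ sum (map (𝟙 ∘ P?) xs)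
length-filter≡∑𝟙 P? []       = refl
length-filter≡∑𝟙 P? (x ∷ xs) with P? x
... | yes _ = cong suc (length-filter≡∑𝟙 P? xs)
... | no _  = length-filter≡∑𝟙 P? xs

sum-tabulate : ∀ n (g : Fin n → ℕ) (h : ℕ → ℕ) → (∀ i → g i ≡ h (toℕ i)) → sum (tabulate g) ≡ ∑ n h
sum-tabulate zero    g h g≡h = refl
sum-tabulate (suc n) g h g≡h = cong₂ _+_ (g≡h zero) (sum-tabulate n (g ∘ suc) (h ∘ suc) (g≡h ∘ suc))

toℕ-mod : ∀ {n m} → m < suc n → toℕ (m mod suc n) ≡ m
toℕ-mod m<n = trans (toℕ-fromℕ< _) (m<n⇒m%n≡m m<n)

mod-toℕ : ∀ {n} (i : Fin (suc n)) → toℕ i mod suc n ≡ i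
mod-toℕ i = toℕ-injective (toℕ-mod (toℕ<n i))

module _ {n : ℕ} (φ : Fin (suc n) → ℕ) where

  unroll : ℕ → ℕ
  unroll m = φ (m mod suc n)

  unroll-toℕ : ∀ i → φ i ≡ unroll (toℕ i)
  unroll-toℕ i = cong φ (sym (mod-toℕ i))

  unroll-periodic : unroll (suc n) ≡ unroll 0
  unroll-periodic = cong φ (toℕ-injective (begin
    toℕ (suc n mod suc n)   ≡⟨ toℕ-fromℕ< _ ⟩
    suc n % suc n           ≡⟨ n%n≡0 (suc n) ⟩
    0                       ≡⟨ toℕ-fromℕ< (m%n<n 0 (suc n)) ⟨
    toℕ (0 mod suc n)       ∎))
    where open ≡-Reasoning

  unroll-next : ∀ {m} → m < suc n → φ (next (m mod suc n)) ≡ unroll (suc m)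
  unroll-next m<n = cong (λ x → unroll (suc x)) (toℕ-mod m<n)

  unroll-injective : IsIrreducible φ → ∀ a b → a < suc n → b < suc n → unroll a ≡ unroll b → a ≡ b
  unroll-injective φ-injective a b a<n b<n eq =
    trans (sym (toℕ-mod a<n)) (trans (cong toℕ (φ-injective eq)) (toℕ-mod b<n))

  sumFin≡∑unroll : sumFin φ ≡ ∑ (suc n) unroll
  sumFin≡∑unroll = sum-tabulate (suc n) φ unroll unroll-toℕ

  jumpCount≡count : ∀ p → jumpCount p φ ≡ count (suc n) (λ m → unroll (suc m) <? p * unroll m)
  jumpCount≡count p = begin
    length (filter jump? (allFin (suc n)))  ≡⟨ length-filter≡∑𝟙 jump? (allFin (suc n)) ⟩
    sum (map (𝟙 ∘ jump?) (allFin (suc n)))  ≡⟨ cong sum (map-tabulate id (𝟙 ∘ jump?)) ⟩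
    sum (tabulate (𝟙 ∘ jump?))              ≡⟨ sum-tabulate (suc n) (𝟙 ∘ jump?) jump′ (λ i →
                                                 cong (λ x → 𝟙 (unroll (suc (toℕ i)) <? p * x)) (unroll-toℕ i)) ⟩
    count (suc n) (λ m → unroll (suc m) <? p * unroll m) ∎
    where
    open ≡-Reasoning
    jump? : Decidable (λ i → φ (next i) < p * φ i)
    jump? i = φ (next i) <? p * φ i
    jump′ : ℕ → ℕ
    jump′ m = 𝟙 (unroll (suc m) <? p * unroll m)

module Radix (k : ℕ) where

  p : ℕ
  p = suc (suc k)

  /-unique : ∀ r q → r < p → (r + q * p) / p ≡ q
  /-unique r q r<p = trans (+-distrib-/-∣ʳ r (divides q refl)) (cong₂ _+_ (m<n⇒m/n≡0 r<p) (m*n/n≡m q p))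

  *≤⇒≤/ : ∀ v N → p * v ≤ N → v ≤ N / p
  *≤⇒≤/ v N pv≤N = subst (_≤ N / p) (m*n/n≡m v p) (/-monoˡ-≤ p (subst (_≤ N) (*-comm p v) pv≤N))

  ≤/⇒*≤ : ∀ v N → v ≤ N / p → p * v ≤ N
  ≤/⇒*≤ v N v≤N/p = ≤-trans (subst (_≤ N / p * p) (*-comm v p) (*-monoˡ-≤ p v≤N/p)) (m/n*n≤m N p)

  N≤1+f⇒N/p≤f : ∀ N f → N ≤ suc f → N / p ≤ f
  N≤1+f⇒N/p≤f zero    f _   = z≤n
  N≤1+f⇒N/p≤f (suc N) f N≤ = s≤s⁻¹ (≤-trans (m/n<m (suc N) p (s<s z<s)) N≤)

  [p*x∸1]/p≡x∸1 : ∀ x → 0 < x → (p * x ∸ 1) / p ≡ x ∸ 1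
  [p*x∸1]/p≡x∸1 (suc M) _ = trans (cong (_/ p) eq) (/-unique (suc k) M ≤-refl)
    where
    eq : p * suc M ∸ 1 ≡ suc k + M * p
    eq = trans (cong (_∸ 1) (*-suc p M)) (cong (suc k +_) (*-comm p M))

  suc-/-cases : ∀ M → (¬ p ∣ suc M × suc M / p ≡ M / p) ⊎ (p ∣ suc M × suc M / p ≡ suc (M / p))
  suc-/-cases M with suc (M % p) <? p
  ... | yes r+1<p = inj₁ (p∤ , trans (cong (_/ p) M+1≡) (/-unique (suc (M % p)) (M / p) r+1<p))
    where
    M+1≡ : suc M ≡ suc (M % p) + M / p * p
    M+1≡ = cong suc (m≡m%n+[m/n]*n M p)
    p∤ : ¬ p ∣ suc M
    p∤ p∣ = 0≢1+n (begin
      0                                 ≡⟨ n∣m⇒m%n≡0 (suc M) p p∣ ⟨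
      suc M % p                         ≡⟨ cong (_% p) M+1≡ ⟩
      (suc (M % p) + M / p * p) % p     ≡⟨ [m+kn]%n≡m%n (suc (M % p)) (M / p) p ⟩
      suc (M % p) % p                   ≡⟨ m<n⇒m%n≡m r+1<p ⟩
      suc (M % p)                       ∎)
      where open ≡-Reasoning
  ... | no r+1≮p = inj₂ (divides (suc (M / p)) M+1≡ , trans (cong (_/ p) M+1≡) (m*n/n≡m (suc (M / p)) p))
    where
    M+1≡ : suc M ≡ suc (M / p) * p
    M+1≡ = trans (cong suc (m≡m%n+[m/n]*n M p))
                 (cong (_+ M / p * p) (≤-antisym (m%n<n M p) (≮⇒≥ r+1≮p)))

  PFree : Pred ℕ 0ℓ
  PFree b = 1 ≤ b × ¬ p ∣ b

  pFree? : Decidable PFree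
  pFree? b = (1 ≤? b) ×-dec ¬? (p ∣? b)

  count-pFree : ∀ M → count (suc M) pFree? ≡ M ∸ M / p
  count-pFree zero    = refl
  count-pFree (suc M) = begin
    count (suc (suc M)) pFree?                 ≡⟨ ∑-snoc (suc M) (λ b → 𝟙 (pFree? b)) ⟩
    count (suc M) pFree? + 𝟙 (pFree? (suc M))  ≡⟨ cong (_+ 𝟙 (pFree? (suc M))) (count-pFree M) ⟩
    M ∸ M / p + 𝟙 (pFree? (suc M))             ≡⟨ step (suc-/-cases M) ⟩
    suc M ∸ suc M / p                          ∎
    where
    open ≡-Reasoning
    step : (¬ p ∣ suc M × suc M / p ≡ M / p) ⊎ (p ∣ suc M × suc M / p ≡ suc (M / p)) →
           M ∸ M / p + 𝟙 (pFree? (suc M)) ≡ suc M ∸ suc M / p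
    step (inj₁ (p∤ , eq)) = begin
      M ∸ M / p + 𝟙 (pFree? (suc M))  ≡⟨ cong (M ∸ M / p +_) (𝟙-yes (pFree? (suc M)) (s≤s z≤n , p∤)) ⟩
      M ∸ M / p + 1                   ≡⟨ +-comm _ 1 ⟩
      suc (M ∸ M / p)                 ≡⟨ +-∸-assoc 1 (m/n≤m M p) ⟨
      suc M ∸ M / p                   ≡⟨ cong (suc M ∸_) eq ⟨
      suc M ∸ suc M / p               ∎
    step (inj₂ (p∣ , eq)) = begin
      M ∸ M / p + 𝟙 (pFree? (suc M))  ≡⟨ cong (M ∸ M / p +_) (𝟙-no (pFree? (suc M)) (λ pf → proj₂ pf p∣)) ⟩
      M ∸ M / p + 0                   ≡⟨ +-identityʳ _ ⟩
      suc M ∸ suc (M / p)             ≡⟨ cong (suc M ∸_) eq ⟨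
      suc M ∸ suc M / p               ∎

  gcd≡1⇒∤ : ∀ b → gcd b p ≡ 1 → ¬ p ∣ b
  gcd≡1⇒∤ b gcd≡1 p∣b with gcd≡1⇒coprime gcd≡1 (p∣b , ∣-refl)
  ... | ()

  ∤⇒gcd≡1 : Prime p → ∀ b → ¬ p ∣ b → gcd b p ≡ 1
  ∤⇒gcd≡1 p-prime b p∤b with prime⇒irreducible p-prime (gcd[m,n]∣n b p)
  ... | inj₁ gcd≡1 = gcd≡1
  ... | inj₂ gcd≡p = ⊥-elim (p∤b (subst (_∣ b) gcd≡p (gcd[m,n]∣m b p)))

  bound : ℕ → ℕ
  bound s = s + ceilDiv s (p ∸ 1) ∸ 1

  -- Together with count-pFree, this says that E_s has exactly s elements.
  bound-pFree : ∀ s → 1 ≤ s → bound s ∸ bound s / p ≡ s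
  bound-pFree (suc s′) _ = begin
    bound (suc s′) ∸ bound (suc s′) / p  ≡⟨ cong (λ x → s′ + x ∸ (s′ + x) / p) ceil≡ ⟩
    s′ + (c + 1) ∸ (s′ + (c + 1)) / p    ≡⟨ cong (λ x → s′ + (c + 1) ∸ x / p) bound≡ ⟩
    s′ + (c + 1) ∸ (suc ρ + c * p) / p   ≡⟨ cong (s′ + (c + 1) ∸_) (/-unique (suc ρ) c (s<s (m%n<n s′ (suc k)))) ⟩
    s′ + (c + 1) ∸ c                     ≡⟨ cong (_∸ c) (solve 2 (λ s′ c → s′ :+ (c :+ con 1) := con 1 :+ s′ :+ c)
                                                                  refl s′ c) ⟩
    suc s′ + c ∸ c                       ≡⟨ m+n∸n≡m (suc s′) c ⟩
    suc s′                               ∎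
    where
    open ≡-Reasoning
    open +-*-Solver
    ρ c : ℕ
    ρ = s′ % suc k
    c = s′ / suc k
    ceil≡ : ceilDiv (suc s′) (p ∸ 1) ≡ c + 1
    ceil≡ = trans (cong (_/ suc k) (sym (+-suc s′ k)))
                  (trans (+-distrib-/-∣ʳ s′ (divides 1 (sym (+-identityʳ (suc k))))) (cong (c +_) (n/n≡1 (suc k))))
    bound≡ : s′ + (c + 1) ≡ suc ρ + c * p
    bound≡ = trans (cong (_+ (c + 1)) (m≡m%n+[m/n]*n s′ (suc k)))
      (solve 3 (λ ρ c k → ρ :+ c :* (con 1 :+ k) :+ (c :+ con 1) := con 1 :+ ρ :+ c :* (con 2 :+ k))
               refl ρ c k)

  -- Windows and capacity

  window : ℕ → (ℕ → ℕ) → ℕ → ℕ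
  window n v N = count n (λ i → (N <? p * v i) ×-dec (v i ≤? N))

  count≤-split : ∀ n v N →
    count n (λ i → v i ≤? N) ≡ count n (λ i → v i ≤? N / p) + window n v N
  count≤-split n v N = trans (∑-cong n (λ i _ → pointwise (v i)))
    (∑-distrib-+ n (λ i → 𝟙 (v i ≤? N / p)) (λ i → 𝟙 ((N <? p * v i) ×-dec (v i ≤? N))))
    where
    pointwise : ∀ x → 𝟙 (x ≤? N) ≡ 𝟙 (x ≤? N / p) + 𝟙 ((N <? p * x) ×-dec (x ≤? N))
    pointwise x with x ≤? N / p
    ... | yes x≤N/p = trans (𝟙-yes (x ≤? N) (≤-trans x≤N/p (m/n≤m N p)))
      (cong suc (sym (𝟙-no ((N <? p * x) ×-dec (x ≤? N)) (λ (N<px , _) → <⇒≱ N<px (≤/⇒*≤ x N x≤N/p)))))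
    ... | no x≰N/p = 𝟙-cong (x ≤? N) ((N <? p * x) ×-dec (x ≤? N))
      (λ x≤N → ≰⇒> (λ px≤N → x≰N/p (*≤⇒≤/ x N px≤N)) , x≤N) proj₂

  window≤ : ∀ n v N → (∀ i i′ → i < n → i′ < n → v i ≡ v i′ → i ≡ i′) → window n v N ≤ N ∸ N / p
  window≤ n v N v-injective = ≤-trans
    (count-≤-injection n (N ∸ N / p) _ (λ _ → yes tt) (λ i → v i ∸ suc (N / p)) into inj)
    (≤-reflexive (count-all (λ _ → yes tt) (N ∸ N / p) (λ _ _ → tt)))
    where
    above : ∀ {x} → N < p * x → suc (N / p) ≤ x
    above N<px = ≰⇒> (λ x≤N/p → <⇒≱ N<px (≤/⇒*≤ _ N x≤N/p))
    into : ∀ i → i < n → N < p * v i × v i ≤ N → v i ∸ suc (N / p) < N ∸ N / p × ⊤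
    into i _ (N<pv , v≤N) = ≤-trans (≤-reflexive (sym (+-∸-assoc 1 (above N<pv)))) (∸-monoˡ-≤ (N / p) v≤N) , tt
    inj : ∀ i i′ → i < n → i′ < n → N < p * v i × v i ≤ N → N < p * v i′ × v i′ ≤ N →
          v i ∸ suc (N / p) ≡ v i′ ∸ suc (N / p) → i ≡ i′
    inj i i′ i<n i′<n (N<pv , _) (N<pv′ , _) eq = v-injective i i′ i<n i′<n
      (trans (sym (m∸n+n≡m (above N<pv))) (trans (cong (_+ suc (N / p)) eq) (m∸n+n≡m (above N<pv′))))

  module _ (s : ℕ) where

    capacity : ℕ → ℕ → ℕ
    capacity zero    N = 0
    capacity (suc f) N = s ⊓ (N ∸ N / p) + capacity f (N / p)

    capacity≤ : ∀ f N → capacity f N ≤ N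
    capacity≤ zero    N = z≤n
    capacity≤ (suc f) N = ≤-trans (+-mono-≤ (m⊓n≤n s _) (capacity≤ f (N / p))) (≤-reflexive (m∸n+n≡m (m/n≤m N p)))

    capacity-pow : ∀ j f m → capacity f (suc m * p ^ j ∸ 1) ≤ j * s + m
    capacity-pow zero    f       m = subst (λ N → capacity f (N ∸ 1) ≤ m) (sym (*-identityʳ (suc m))) (capacity≤ f m)
    capacity-pow (suc j) zero    m = z≤n
    capacity-pow (suc j) (suc f) m = begin
      s ⊓ (N ∸ N / p) + capacity f (N / p)          ≤⟨ +-monoˡ-≤ _ (m⊓n≤m s _) ⟩
      s + capacity f (N / p)                        ≡⟨ cong (λ x → s + capacity f x) N/p≡ ⟩
      s + capacity f (suc m * p ^ j ∸ 1)            ≤⟨ +-monoʳ-≤ s (capacity-pow j f m) ⟩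
      s + (j * s + m)                               ≡⟨ +-assoc s (j * s) m ⟨
      suc j * s + m                                 ∎
      where
      open ≤-Reasoning
      N : ℕ
      N = suc m * p ^ suc j ∸ 1
      N/p≡ : N / p ≡ suc m * p ^ j ∸ 1
      N/p≡ = trans (cong (λ x → (x ∸ 1) / p) (x∙yz≈y∙xz *-commutativeSemigroup (suc m) p (p ^ j)))
                   ([p*x∸1]/p≡x∸1 (suc m * p ^ j) (*-mono-≤ (s≤s (z≤n {m})) (m^n>0 p j)))

    module _ (n : ℕ) (v : ℕ → ℕ) (v-positive : ∀ i → i < n → 0 < v i)
             (v-injective : ∀ i i′ → i < n → i′ < n → v i ≡ v i′ → i ≡ i′)
             (window≤s : ∀ N → window n v N ≤ s) where

      count≤capacity : ∀ f N → N ≤ f → count n (λ i → v i ≤? N) ≤ capacity f N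
      count≤capacity zero    .zero z≤n = ≤-reflexive (count-none _ n (λ i i<n v≤0 → <⇒≱ (v-positive i i<n) v≤0))
      count≤capacity (suc f) N N≤f = begin
        count n (λ i → v i ≤? N)                          ≡⟨ count≤-split n v N ⟩
        count n (λ i → v i ≤? N / p) + window n v N       ≤⟨ +-mono-≤ (count≤capacity f (N / p) (N≤1+f⇒N/p≤f N f N≤f))
                                                                      (⊓-glb (window≤s N) (window≤ n v N v-injective)) ⟩
        capacity f (N / p) + s ⊓ (N ∸ N / p)              ≡⟨ +-comm (capacity f (N / p)) _ ⟩
        capacity (suc f) N                                ∎
        where open ≤-Reasoning

  module _ (ℓ : ℕ) (ψ : ℕ → ℕ) (periodic : ψ ℓ ≡ ψ 0) (step≤ : ∀ m → m < ℓ → ψ (suc m) ≤ p * ψ m) where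

    jumps : ℕ
    jumps = count ℓ (λ m → ψ (suc m) <? p * ψ m)

    -- An index in the window without a jump is an exit from {ψ ≤ N}, since then ψ (suc m) = p * ψ m > N;
    -- an entry into {ψ ≤ N} needs a jump, and around the cycle exits and entries balance out.
    window≤jumps : ∀ N → window ℓ ψ N ≤ jumps
    window≤jumps N = +-cancelʳ-≤ (∑ ℓ low) (window ℓ ψ N) jumps (begin
      window ℓ ψ N + ∑ ℓ low             ≡⟨ cong (window ℓ ψ N +_) (∑-shift-periodic ℓ low low-periodic) ⟨
      window ℓ ψ N + ∑ ℓ (low ∘ suc)     ≡⟨ ∑-distrib-+ ℓ win (low ∘ suc) ⟨
      ∑[ m < ℓ ] (win m + low (suc m))   ≤⟨ ∑-mono-≤ ℓ win+low′≤jump+low ⟩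
      ∑[ m < ℓ ] (jump m + low m)        ≡⟨ ∑-distrib-+ ℓ jump low ⟩
      jumps + ∑ ℓ low                    ∎)
      where
      open ≤-Reasoning
      low win jump : ℕ → ℕ
      low  m = 𝟙 (ψ m ≤? N)
      win  m = 𝟙 ((N <? p * ψ m) ×-dec (ψ m ≤? N))
      jump m = 𝟙 (ψ (suc m) <? p * ψ m)
      low-periodic : low ℓ ≡ low 0
      low-periodic = cong (λ x → 𝟙 (x ≤? N)) periodic
      win≤low : ∀ m → win m ≤ low m
      win≤low m = 𝟙-mono _ (ψ m ≤? N) proj₂
      no-jump⇒step≡ : ∀ m → m < ℓ → ¬ ψ (suc m) < p * ψ m → ψ (suc m) ≡ p * ψ m
      no-jump⇒step≡ m m<ℓ no-jump = ≤-antisym (step≤ m m<ℓ) (≮⇒≥ no-jump)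
      win+low′≤jump+low : ∀ m → m < ℓ → win m + low (suc m) ≤ jump m + low m
      win+low′≤jump+low m m<ℓ with ψ (suc m) <? p * ψ m
      ... | yes _ = ≤-trans (+-mono-≤ (win≤low m) (𝟙≤1 (ψ (suc m) ≤? N))) (≤-reflexive (+-comm (low m) 1))
      ... | no no-jump with ψ (suc m) ≤? N
      ...   | no _     = ≤-trans (≤-reflexive (+-identityʳ (win m))) (win≤low m)
      ...   | yes ψ′≤N = ≤-reflexive (trans (cong (_+ 1) win≡0) (sym (𝟙-yes (ψ m ≤? N) ψ≤N)))
        where
        ψ′≡ = no-jump⇒step≡ m m<ℓ no-jump
        win≡0 = 𝟙-no _ (λ (N<pψ , _) → <⇒≱ N<pψ (subst (_≤ N) ψ′≡ ψ′≤N))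
        ψ≤N = ≤-trans (subst (ψ m ≤_) (sym ψ′≡) (m≤n*m (ψ m) p)) ψ′≤N

  -- The enumeration of F_s

  p*[p^e*b]≤p^e′*b : ∀ {e e′} b → e < e′ → p * (p ^ e * b) ≤ p ^ e′ * b
  p*[p^e*b]≤p^e′*b {e} {e′} b e<e′ = subst (_≤ p ^ e′ * b) (*-assoc p (p ^ e) b) (*-monoˡ-≤ b (^-monoʳ-≤ p e<e′))

  module Enumeration (s : ℕ) (1≤s : 1 ≤ s) (p-prime : Prime p)
                     (c : ℕ → ℕ) (enum : IsIncreasingEnumOfF p s c) where
    open IsIncreasingEnumOfF enum

    c-mono-< : ∀ {i j} → i < j → c i < c j
    c-mono-< {i} {suc j} (s≤s i≤j) with m≤n⇒m<n∨m≡n i≤j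
    ... | inj₁ i<j  = <-trans (c-mono-< i<j) (strictlyIncreasing j)
    ... | inj₂ refl = strictlyIncreasing i

    c-mono-≤ : ∀ {i j} → i ≤ j → c i ≤ c j
    c-mono-≤ i≤j with m≤n⇒m<n∨m≡n i≤j
    ... | inj₁ i<j  = <⇒≤ (c-mono-< i<j)
    ... | inj₂ refl = ≤-refl

    c-cancel-< : ∀ {i j} → c i < c j → i < j
    c-cancel-< ci<cj = ≰⇒> (λ j≤i → <⇒≱ ci<cj (c-mono-≤ j≤i))

    c-injective : ∀ {i j} → c i ≡ c j → i ≡ j
    c-injective {i} {j} ci≡cj with <-cmp i j
    ... | tri< i<j _ _ = ⊥-elim (<⇒≢ (c-mono-< i<j) ci≡cj)
    ... | tri≈ _ i≡j _ = i≡j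
    ... | tri> _ _ j<i = ⊥-elim (<⇒≢ (c-mono-< j<i) (sym ci≡cj))

    i≤c[i] : ∀ i → i ≤ c i
    i≤c[i] zero    = z≤n
    i≤c[i] (suc i) = ≤-<-trans (i≤c[i] i) (strictlyIncreasing i)

    exponent base : ℕ → ℕ
    exponent i = proj₁ (inF i)
    base     i = proj₁ (proj₂ (inF i))

    base∈E : ∀ i → InE p s (base i)
    base∈E i = proj₁ (proj₂ (proj₂ (inF i)))

    c-factorisation : ∀ i → c i ≡ p ^ exponent i * base i
    c-factorisation i = proj₂ (proj₂ (proj₂ (inF i)))

    c-positive : ∀ i → 0 < c i
    c-positive i = subst (0 <_) (sym (c-factorisation i)) (*-mono-≤ (m^n>0 p (exponent i)) (proj₁ (base∈E i)))

    indexOf : ∀ x → InF p s x → ℕ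
    indexOf x x∈F = proj₁ (onto x x∈F)

    c-indexOf : ∀ x x∈F → c (indexOf x x∈F) ≡ x
    c-indexOf x x∈F = proj₂ (onto x x∈F)

    window-c≤s : ∀ n N → window n c N ≤ s
    window-c≤s n N = begin
      window n c N               ≤⟨ count-≤-injection n (suc B) _ pFree? base (λ i _ _ → into i) inj ⟩
      count (suc B) pFree?       ≡⟨ count-pFree B ⟩
      B ∸ B / p                  ≡⟨ bound-pFree s 1≤s ⟩
      s                          ∎
      where
      open ≤-Reasoning
      B : ℕ
      B = bound s
      into : ∀ i → base i < suc B × PFree (base i)
      into i = let (1≤b , b≤B , gcd≡1) = base∈E i in s≤s b≤B , 1≤b , gcd≡1⇒∤ (base i) gcd≡1
      exponent-≤ : ∀ i j → N < p * c i → c j ≤ N → base i ≡ base j → exponent j ≤ exponent i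
      exponent-≤ i j N<pci cj≤N bi≡bj = ≮⇒≥ (λ ei<ej → <⇒≱ N<pci (≤-trans (begin
        p * c i                         ≡⟨ cong (p *_) (c-factorisation i) ⟩
        p * (p ^ exponent i * base i)   ≤⟨ p*[p^e*b]≤p^e′*b (base i) ei<ej ⟩
        p ^ exponent j * base i         ≡⟨ cong (p ^ exponent j *_) bi≡bj ⟩
        p ^ exponent j * base j         ≡⟨ c-factorisation j ⟨
        c j                             ∎) cj≤N))
      inj : ∀ i j → i < n → j < n → N < p * c i × c i ≤ N → N < p * c j × c j ≤ N → base i ≡ base j → i ≡ j
      inj i j _ _ (N<pci , ci≤N) (N<pcj , cj≤N) bi≡bj = c-injective (begin-equality
        c i                       ≡⟨ c-factorisation i ⟩
        p ^ exponent i * base i   ≡⟨ cong₂ (λ e b → p ^ e * b) e≡ bi≡bj ⟩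
        p ^ exponent j * base j   ≡⟨ c-factorisation j ⟨
        c j                       ∎)
        where
        e≡ : exponent i ≡ exponent j
        e≡ = ≤-antisym (exponent-≤ j i N<pcj ci≤N (sym bi≡bj)) (exponent-≤ i j N<pci cj≤N bi≡bj)

    s⊓[N∸N/p]≤count-pFree : ∀ N → s ⊓ (N ∸ N / p) ≤ count (suc N) (λ i → (c i ≤? N) ×-dec ¬? (p ∣? c i))
    s⊓[N∸N/p]≤count-pFree N = begin
      s ⊓ (N ∸ N / p)          ≤⟨ min≤ (≤-total N (bound s)) ⟩
      M ∸ M / p                ≡⟨ count-pFree M ⟨
      count (suc M) pFree?     ≤⟨ count-≤-cover (suc M) (suc N) pFree? (λ i → (c i ≤? N) ×-dec ¬? (p ∣? c i))
                                                  c covered ⟩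
      count (suc N) (λ i → (c i ≤? N) ×-dec ¬? (p ∣? c i)) ∎
      where
      open ≤-Reasoning
      M : ℕ
      M = N ⊓ bound s
      min≤ : N ≤ bound s ⊎ bound s ≤ N → s ⊓ (N ∸ N / p) ≤ M ∸ M / p
      min≤ (inj₁ N≤B) rewrite m≤n⇒m⊓n≡m N≤B = m⊓n≤n s _
      min≤ (inj₂ B≤N) rewrite m≥n⇒m⊓n≡n B≤N | bound-pFree s 1≤s = m⊓n≤m s _
      covered : ∀ b → b < suc M → PFree b → ∃ λ i → i < suc N × (c i ≤ N × ¬ p ∣ c i) × c i ≡ b
      covered b (s≤s b≤M) (1≤b , p∤b) =
        i , s≤s (≤-trans (i≤c[i] i) ci≤N) , (ci≤N , subst (λ x → ¬ p ∣ x) (sym ci≡b) p∤b) , ci≡b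
        where
        b∈F : InF p s b
        b∈F = 0 , b , (1≤b , ≤-trans b≤M (m⊓n≤n N _) , ∤⇒gcd≡1 p-prime b p∤b) , sym (*-identityˡ b)
        i = indexOf b b∈F
        ci≡b = c-indexOf b b∈F
        ci≤N = subst (_≤ N) (sym ci≡b) (≤-trans b≤M (m⊓n≤m N _))

    count[c≤N/p]≤count-divisible : ∀ N →
      count (suc (N / p)) (λ i → c i ≤? N / p) ≤ count (suc N) (λ i → (c i ≤? N) ×-dec (p ∣? c i))
    count[c≤N/p]≤count-divisible N = count-≤-injection (suc (N / p)) (suc N)
      (λ i → c i ≤? N / p) (λ i → (c i ≤? N) ×-dec (p ∣? c i)) index[p*c] into inj
      where
      p*c∈F : ∀ i → InF p s (p * c i)
      p*c∈F i = suc (exponent i) , base i , base∈E i ,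
                trans (cong (p *_) (c-factorisation i)) (sym (*-assoc p (p ^ exponent i) (base i)))
      index[p*c] : ℕ → ℕ
      index[p*c] i = indexOf (p * c i) (p*c∈F i)
      c∘index[p*c] : ∀ i → c (index[p*c] i) ≡ p * c i
      c∘index[p*c] i = c-indexOf (p * c i) (p*c∈F i)
      into : ∀ i → i < suc (N / p) → c i ≤ N / p →
             index[p*c] i < suc N × (c (index[p*c] i) ≤ N × p ∣ c (index[p*c] i))
      into i _ ci≤N/p = s≤s (≤-trans (i≤c[i] _) c≤N) , c≤N , subst (p ∣_) (sym (c∘index[p*c] i)) (m∣m*n (c i))
        where c≤N = subst (_≤ N) (sym (c∘index[p*c] i)) (≤/⇒*≤ (c i) N ci≤N/p)
      inj : ∀ i j → i < suc (N / p) → j < suc (N / p) → c i ≤ N / p → c j ≤ N / p →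
            index[p*c] i ≡ index[p*c] j → i ≡ j
      inj i j _ _ _ _ eq = c-injective (*-cancelˡ-≡ (c i) (c j) p
        (trans (sym (c∘index[p*c] i)) (trans (cong c eq) (c∘index[p*c] j))))

    capacity≤count : ∀ f N → capacity s f N ≤ count (suc N) (λ i → c i ≤? N)
    capacity≤count zero    N = z≤n
    capacity≤count (suc f) N = begin
      s ⊓ (N ∸ N / p) + capacity s f (N / p)
        ≤⟨ +-mono-≤ (s⊓[N∸N/p]≤count-pFree N) (capacity≤count f (N / p)) ⟩
      count (suc N) (λ i → (c i ≤? N) ×-dec ¬? (p ∣? c i)) + count (suc (N / p)) (λ i → c i ≤? N / p)
        ≤⟨ +-monoʳ-≤ (count (suc N) (λ i → (c i ≤? N) ×-dec ¬? (p ∣? c i))) (count[c≤N/p]≤count-divisible N) ⟩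
      count (suc N) (λ i → (c i ≤? N) ×-dec ¬? (p ∣? c i)) + count (suc N) (λ i → (c i ≤? N) ×-dec (p ∣? c i))
        ≡⟨ count-partition (suc N) (λ i → c i ≤? N) (λ i → p ∣? c i) ⟨
      count (suc N) (λ i → c i ≤? N) ∎
      where open ≤-Reasoning

    c-lower-bound : ∀ j m → suc m * p ^ j ≤ c (j * s + m)
    c-lower-bound j m with suc m * p ^ j ≤? c (j * s + m)
    ... | yes bound≤c = bound≤c
    ... | no  bound≰c = ⊥-elim (1+n≰n (begin
      suc K                                ≡⟨ count-all (λ i → c i ≤? N) (suc K) (λ i i≤K → ≤-trans (c-mono-≤ (s≤s⁻¹ i≤K)) cK≤N) ⟨
      count (suc K) (λ i → c i ≤? N)       ≤⟨ count≤capacity s (suc K) c (λ i _ → c-positive i) (λ _ _ _ _ → c-injective)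
                                                             (window-c≤s (suc K)) N N ≤-refl ⟩
      capacity s N N                       ≤⟨ capacity-pow s j N m ⟩
      K                                    ∎))
      where
      open ≤-Reasoning
      K N : ℕ
      K = j * s + m
      N = suc m * p ^ j ∸ 1
      cK≤N : c K ≤ N
      cK≤N = <⇒≤pred (≰⇒> bound≰c)

    count-below-c≤ : ∀ n v → (∀ i → i < n → 0 < v i) → (∀ i i′ → i < n → i′ < n → v i ≡ v i′ → i ≡ i′) →
      (∀ N → window n v N ≤ s) → ∀ R → count n (λ i → v i <? c R) ≤ R
    count-below-c≤ n v v-positive v-injective window≤s R = begin
      count n (λ i → v i <? c R)       ≤⟨ count-mono n _ (λ i → v i ≤? N) (λ _ _ → <⇒≤pred) ⟩
      count n (λ i → v i ≤? N)         ≤⟨ count≤capacity s n v v-positive v-injective window≤s N N ≤-refl ⟩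
      capacity s N N                   ≤⟨ capacity≤count N N ⟩
      count (suc N) (λ i → c i ≤? N)   ≤⟨ count-≤-injection (suc N) R (λ i → c i ≤? N) (λ _ → yes tt) id
                                            (λ i _ ci≤N → c-cancel-< (m≤pred[n]⇒suc[m]≤n ci≤N) , tt)
                                            (λ _ _ _ _ _ _ → id) ⟩
      count R (λ _ → yes tt)           ≡⟨ count-all (λ _ → yes tt) R (λ _ _ → tt) ⟩
      R                                ∎
      where
      open ≤-Reasoning
      instance _ = >-nonZero (c-positive R)
      N : ℕ
      N = pred (c R)

    ∑c≤sumFin : ∀ {n t} (φ : Fin (suc n) → ℕ) → IsSupportMap p (suc n) t φ → IsIrreducible φ → t ≤ s →
      ∑ (suc n) c ≤ sumFin φ
    ∑c≤sumFin {n} φ φ-support φ-injective t≤s = begin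
      ∑ (suc n) c              ≤⟨ ∑≤∑-byRank (suc n) ψ ψ-injective c
                                    (count-below-c≤ (suc n) ψ (λ m _ → positive (m mod suc n)) ψ-injective window≤s) ⟩
      ∑ (suc n) ψ              ≡⟨ sumFin≡∑unroll φ ⟨
      sumFin φ                 ∎
      where
      open ≤-Reasoning
      open IsSupportMap φ-support renaming (jumps to jumps≡t)
      ψ : ℕ → ℕ
      ψ = unroll φ
      ψ-injective = unroll-injective φ φ-injective
      step≤ : ∀ m → m < suc n → ψ (suc m) ≤ p * ψ m
      step≤ m m<ℓ = subst (_≤ p * ψ m) (unroll-next φ m<ℓ) (stepOrJump (m mod suc n))
      window≤s : ∀ N → window (suc n) ψ N ≤ s
      window≤s N = ≤-trans (window≤jumps (suc n) ψ (unroll-periodic φ) step≤ N)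
                           (≤-trans (≤-reflexive (trans (sym (jumpCount≡count φ p)) jumps≡t)) t≤s)

    lower-bound≤∑c : ∀ q r → (s * suc s / 2) * geom p q + (r * suc r / 2) * p ^ q ≤ ∑ (q * s + r) c
    lower-bound≤∑c q r = begin
      (s * suc s / 2) * geom p q + (r * suc r / 2) * p ^ q
        ≡⟨ cong₂ _+_ (trans (*-geom (s * suc s / 2) p q) (∑-cong q (λ j _ → triangle s (p ^ j))))
                     (triangle r (p ^ q)) ⟩
      (∑[ j < q ] ∑[ m < s ] suc m * p ^ j) + (∑[ m < r ] suc m * p ^ q)
        ≤⟨ +-mono-≤ (∑-mono-≤ q (λ j _ → ∑-mono-≤ s (λ m _ → c-lower-bound j m)))
                    (∑-mono-≤ r (λ m _ → c-lower-bound q m)) ⟩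
      (∑[ j < q ] ∑[ m < s ] c (j * s + m)) + (∑[ m < r ] c (q * s + m))
        ≡⟨ cong (_+ (∑[ m < r ] c (q * s + m))) (∑-blocks q s c) ⟨
      ∑ (q * s) c + (∑[ m < r ] c (q * s + m))
        ≡⟨ ∑-split (q * s) r c ⟨
      ∑ (q * s + r) c ∎
      where
      open ≤-Reasoning
      triangle : ∀ n a → n * suc n / 2 * a ≡ ∑[ m < n ] suc m * a
      triangle n a = trans (cong (_* a) (sym (∑-suc n))) (sym (∑-distribʳ-* n a suc))

lemma1p10 : (p s ℓ t q r : ℕ) (φ : Fin ℓ → ℕ) (c : ℕ → ℕ) →
    Prime p → 1 ≤ s →
    IsSupportMap p ℓ t φ → IsIrreducible φ →
    1 ≤ t → t ≤ s →
    ℓ ≡ q * s + r → 1 ≤ r → r ≤ s →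
    IsIncreasingEnumOfF p s c →
    (sumFin φ ≥ sumFirst ℓ c)
      × (sumFirst ℓ c ≥ (s * suc s / 2) * geom p q + (r * suc r / 2) * p ^ q)
lemma1p10 0 _ _ _ _ _ _ _ p-prime = ⊥-elim (¬prime[0] p-prime)
lemma1p10 1 _ _ _ _ _ _ _ p-prime = ⊥-elim (¬prime[1] p-prime)
lemma1p10 (suc (suc k)) s zero t q r _ _ _ _ _ _ _ _ 0≡qs+r 1≤r _ _ =
  ⊥-elim (<⇒≱ (≤-trans 1≤r (m≤n+m r (q * s))) (≤-reflexive (sym 0≡qs+r)))
lemma1p10 (suc (suc k)) s ℓ@(suc _) t q r φ c p-prime 1≤s φ-support φ-injective _ t≤s ℓ≡qs+r _ _ c-enum =
  subst (_≤ sumFin φ) (sym ∑c≡) (∑c≤sumFin φ φ-support φ-injective t≤s) ,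
  subst (_ ≤_) (sym (trans ∑c≡ (cong (λ n → ∑ n c) ℓ≡qs+r))) (lower-bound≤∑c q r)
  where
  open Radix k
  open Enumeration s 1≤s p-prime c c-enum
  ∑c≡ : sumFirst ℓ c ≡ ∑ ℓ c
  ∑c≡ = sum-map-applyUpTo ℓ c id
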